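{- Let $n,r$ be positive integers, let $\Gamma=\{P(w)^{\otimes r}\mid w\in W_n\}$, and let $\Omega$ be the set of doubly stochastic matrices in the real linear span of $\Gamma$. Index rows and columns of $n^r\times n^r$ matrices by $\{1,\dots,n\}^r$, writing $M=[m_{i_1\cdots i_r,\, j_1\cdots j_r}]$. The following are equivalent: (a) $\Omega$ equals the convex hull of $\Gamma$; (b) every $M\in\Omega$ has a positive Kronecker power diagonal, i.e., there exists $w\in W_n$ such that $m_{w(j_1)w(j_2)\cdots w(j_r),\, j_1j_2\cdots j_r} > 0$ for all $j_1,\dots,j_r \in \{1,\dots,n\}$.
   Context: $W_n$ is the symmetric group on $\{1,\dots,n\}$; $P(w)=[\delta_{i,w(j)}]$ is the $n\times n$ real permutation matrix of $w$ and $P(w)^{\otimes r}$ its $r$th Kronecker power, whose $(i_1\cdots i_r, j_1\cdots j_r)$ entry is $\prod_{a=1}^r \delta_{i_a,w(j_a)}$. A square matrix is doubly stochastic if its entries are nonnegative reals and every row and column sums to $1$. -}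

module Defs where

open import Level using (0ℓ)
open import Data.Nat using (ℕ; zero; suc)
open import Data.Fin using (Fin)
import Data.Fin as Fin
open import Data.Fin.Properties using () renaming (_≟_ to _≟ᶠ_)
open import Data.Fin.Permutation using (Permutation′; _⟨$⟩ʳ_)
open import Data.Vec.Functional using () renaming (_∷_ to _◂_)
open import Data.List using (List; []; _∷_)
open import Data.List.Relation.Unary.All using (All)
open import Data.Product using (Σ; ∃; _×_; _,_; proj₁; proj₂)
open import Data.Sum using (_⊎_)
open import Relation.Nullary using (¬_; yes; no)
open import Relation.Binary.PropositionalEquality using (_≡_)
open import Relation.Binary.Structures using (IsStrictTotalOrder)
open import Algebra.Structures using (IsCommutativeRing)

-- An axiomatisation of the real numbers: a complete ordered field
-- (any model is isomorphic to ℝ).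
record Reals : Set₁ where
  infixl 6 _+_
  infixl 7 _*_
  infix 4 _<_ _≤_
  field
    Carrier : Set
    _+_ _*_ : Carrier → Carrier → Carrier
    -_ : Carrier → Carrier
    0# 1# : Carrier
    _<_ : Carrier → Carrier → Set
    isCommutativeRing : IsCommutativeRing _≡_ _+_ _*_ -_ 0# 1#
    0≢1 : ¬ (0# ≡ 1#)
    inverse : ∀ x → ¬ (x ≡ 0#) → ∃ λ y → x * y ≡ 1#
    isStrictTotalOrder : IsStrictTotalOrder _≡_ _<_
    +-mono-< : ∀ {x y} z → x < y → x + z < y + z
    *-pos : ∀ {x y} → 0# < x → 0# < y → 0# < x * y

  _≤_ : Carrier → Carrier → Set
  x ≤ y = x < y ⊎ x ≡ y

  field
    lub : (P : Carrier → Set) → (∃ λ x → P x) → (∃ λ b → ∀ x → P x → x ≤ b) →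
          ∃ λ s → (∀ x → P x → x ≤ s) × (∀ b → (∀ x → P x → x ≤ b) → s ≤ b)

module _ (ℝ : Reals) where
  open Reals ℝ

  ∑ : ∀ {k} → (Fin k → Carrier) → Carrier
  ∑ {zero} f = 0#
  ∑ {suc k} f = f Fin.zero + ∑ (λ i → f (Fin.suc i))

  ∏ : ∀ {k} → (Fin k → Carrier) → Carrier
  ∏ {zero} f = 1#
  ∏ {suc k} f = f Fin.zero * ∏ (λ i → f (Fin.suc i))

  MultiIndex : ℕ → ℕ → Set
  MultiIndex n r = Fin r → Fin n

  ∑ᴹ : ∀ {n} r → (MultiIndex n r → Carrier) → Carrier
  ∑ᴹ zero f = f (λ ())
  ∑ᴹ {n} (suc r) f = ∑ {n} (λ x → ∑ᴹ r (λ t → f (x ◂ t)))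

  Matrix : ℕ → ℕ → Set
  Matrix n r = MultiIndex n r → MultiIndex n r → Carrier

  _≈ᴹ_ : ∀ {n r} → Matrix n r → Matrix n r → Set
  M ≈ᴹ N = ∀ i j → M i j ≡ N i j

  δ : ∀ {n} → Fin n → Fin n → Carrier
  δ i j with i ≟ᶠ j
  ... | yes _ = 1#
  ... | no _ = 0#

  kronPerm : ∀ {n} r → Permutation′ n → Matrix n r
  kronPerm r w i j = ∏ (λ a → δ (i a) (w ⟨$⟩ʳ j a))

  combination : ∀ {n} r → List (Carrier × Permutation′ n) → Matrix n r
  combination r [] i j = 0#
  combination r ((c , w) ∷ cs) i j = c * kronPerm r w i j + combination r cs i j

  coeffSum : ∀ {n} → List (Carrier × Permutation′ n) → Carrier
  coeffSum [] = 0#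
  coeffSum ((c , w) ∷ cs) = c + coeffSum cs

  InSpan : ∀ {n} r → Matrix n r → Set
  InSpan {n} r M = ∃ λ (cs : List (Carrier × Permutation′ n)) → M ≈ᴹ combination r cs

  InConvexHull : ∀ {n} r → Matrix n r → Set
  InConvexHull {n} r M = ∃ λ (cs : List (Carrier × Permutation′ n)) →
    All (λ p → 0# ≤ proj₁ p) cs × coeffSum cs ≡ 1# × M ≈ᴹ combination r cs

  DoublyStochastic : ∀ {n} r → Matrix n r → Set
  DoublyStochastic r M =
    (∀ i j → 0# ≤ M i j) ×
    (∀ i → ∑ᴹ r (λ j → M i j) ≡ 1#) ×
    (∀ j → ∑ᴹ r (λ i → M i j) ≡ 1#)

  InΩ : ∀ {n} r → Matrix n r → Set
  InΩ r M = DoublyStochastic r M × InSpan r M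

  HasPosKronDiagonal : ∀ {n} r → Matrix n r → Set
  HasPosKronDiagonal {n} r M =
    ∃ λ (w : Permutation′ n) → ∀ (j : MultiIndex n r) → 0# < M (λ a → w ⟨$⟩ʳ j a) j

{-# OPTIONS --safe #-}
-- (a) ⇒ (b): a convex combination of the P(w)^{⊗r} dominates c · P(w)^{⊗r} for any term c · P(w)^{⊗r}
-- with c > 0, so its w-diagonal is positive.
-- (b) ⇒ (a) is Birkhoff's peeling argument: a matrix M in the span of Γ with nonnegative entries
-- and all line sums s > 0 becomes an element of Ω after division by s, so some w gives a positive
-- diagonal of M.  Subtracting c · P(w)^{⊗r}, where c is the least entry of that diagonal, keeps M
-- nonnegative and in the span, lowers the line sums to s − c and kills at least one positive entry;
-- induction on the number of positive entries ends at line sum 0, i.e. at the zero matrix.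
module Submission where

open import Defs
open import Data.Nat as ℕ using (ℕ; zero; suc; z≤n; s≤s)
import Data.Nat.Properties as ℕₚ
open import Data.Fin using (Fin) renaming (zero to fzero; suc to fsuc)
open import Data.Fin.Properties using (all?; ¬∀⟶∃¬; suc-injective) renaming (_≟_ to _≟ᶠ_)
open import Data.Fin.Permutation using (Permutation′; _⟨$⟩ʳ_; _⟨$⟩ˡ_; inverseˡ; inverseʳ)
open import Data.Vec.Functional using (head; tail) renaming (_∷_ to _◂_)
open import Data.Vec.Functional.Properties using (∷-cong)
open import Data.List using (List; []; _∷_; allFin)
open import Data.List.Relation.Unary.All as All using (All; []; _∷_)
open import Data.List.Membership.Propositional.Properties using (∈-allFin)
open import Data.Product using (∃; ∃₂; _×_; _,_; proj₁; proj₂)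
open import Data.Sum using (inj₁; inj₂)
open import Data.Empty using (⊥-elim)
open import Relation.Nullary using (¬_; Dec; yes; no)
open import Relation.Binary.PropositionalEquality
open import Relation.Binary.Bundles using (TotalOrder)
open import Relation.Binary.Structures using (IsStrictTotalOrder)
open import Relation.Binary.Definitions using (tri<; tri≈; tri>)
import Relation.Binary.Construct.StrictToNonStrict as StrictToNonStrict
open import Algebra.Bundles using (CommutativeRing)
open import Function.Bundles using (_⇔_; mk⇔)
open import Function.Base using (id; _∘_; case_of_)

-- ∑ᴹ samples a function only at indices of the form x ◂ t, so statements about its individual
-- values need this property; every matrix in the span of Γ has it.
Extensional : ∀ {A : Set} {n r : ℕ} → ((Fin r → Fin n) → A) → Set
Extensional f = ∀ {j j′} → j ≗ j′ → f j ≡ f j′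

head◂tail : ∀ {n r} (j : Fin (suc r) → Fin n) → j ≗ head j ◂ tail j
head◂tail j = ∷-cong refl (λ _ → refl)

◂-extensional : ∀ {A : Set} {n r} {f : (Fin (suc r) → Fin n) → A} x →
  Extensional f → Extensional (λ t → f (x ◂ t))
◂-extensional x ext t≗t′ = ext (∷-cong refl t≗t′)

_≟ᴹ_ : ∀ {n r} (i j : Fin r → Fin n) → Dec (i ≗ j)
i ≟ᴹ j = all? (λ a → i a ≟ᶠ j a)

module OrderedFieldProperties (ℝ : Reals) where
  open Reals ℝ

  commutativeRing : CommutativeRing _ _
  commutativeRing = record { isCommutativeRing = isCommutativeRing }

  open CommutativeRing commutativeRing public
    using (+-assoc; +-comm; +-identityˡ; +-identityʳ; *-comm; *-assoc; *-identityˡ; *-identityʳ;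
           distribˡ; zeroˡ; zeroʳ; -‿inverseˡ; -‿inverseʳ)
  open import Algebra.Properties.Ring (CommutativeRing.ring commutativeRing) public
    using (-‿distribˡ-*; -‿distribʳ-*; -‿involutive)
  open import Algebra.Properties.CommutativeSemigroup
    (CommutativeRing.+-commutativeSemigroup commutativeRing) public using (interchange)
  open IsStrictTotalOrder isStrictTotalOrder public
    using (compare; _<?_; <-resp-≈; <-respˡ-≈)
    renaming (irrefl to <-irrefl; trans to <-trans; asym to <-asym)
  private module NonStrict = StrictToNonStrict {A = Carrier} _≡_ _<_

  infixl 6 _-_
  _-_ : Carrier → Carrier → Carrier
  x - y = x + - y

  ≤-totalOrder : TotalOrder _ _ _
  ≤-totalOrder = record { isTotalOrder = NonStrict.isTotalOrder isStrictTotalOrder }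

  ≤-refl : ∀ {x} → x ≤ x
  ≤-refl = inj₂ refl

  ≤-trans : ∀ {x y z} → x ≤ y → y ≤ z → x ≤ z
  ≤-trans = NonStrict.trans isEquivalence <-resp-≈ <-trans

  ≤-<-trans : ∀ {x y z} → x ≤ y → y < z → x < z
  ≤-<-trans = NonStrict.≤-<-trans sym <-trans <-respˡ-≈

  +-mono-≤ : ∀ {x y} z → x ≤ y → x + z ≤ y + z
  +-mono-≤ z (inj₁ x<y) = inj₁ (+-mono-< z x<y)
  +-mono-≤ z (inj₂ refl) = ≤-refl

  +-monoʳ-< : ∀ z {x y} → x < y → z + x < z + y
  +-monoʳ-< z {x} {y} x<y = subst₂ _<_ (+-comm x z) (+-comm y z) (+-mono-< z x<y)

  +-nonneg : ∀ {x y} → 0# ≤ x → 0# ≤ y → 0# ≤ x + y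
  +-nonneg {x} {y} 0≤x 0≤y = ≤-trans 0≤y (subst (_≤ x + y) (+-identityˡ y) (+-mono-≤ y 0≤x))

  +-pos-nonneg : ∀ {x y} → 0# < x → 0# ≤ y → 0# < x + y
  +-pos-nonneg {x} {y} 0<x 0≤y = ≤-<-trans 0≤y (subst (_< x + y) (+-identityˡ y) (+-mono-< y 0<x))

  +-nonneg-≡0 : ∀ {x y} → 0# ≤ x → 0# ≤ y → x + y ≡ 0# → x ≡ 0# × y ≡ 0#
  +-nonneg-≡0 (inj₁ 0<x) 0≤y x+y≡0 = ⊥-elim (<-irrefl (sym x+y≡0) (+-pos-nonneg 0<x 0≤y))
  +-nonneg-≡0 {y = y} (inj₂ refl) _ x+y≡0 = refl , trans (sym (+-identityˡ y)) x+y≡0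

  *-nonneg : ∀ {x y} → 0# ≤ x → 0# ≤ y → 0# ≤ x * y
  *-nonneg (inj₁ 0<x) (inj₁ 0<y) = inj₁ (*-pos 0<x 0<y)
  *-nonneg {x} (inj₁ _) (inj₂ refl) = inj₂ (sym (zeroʳ x))
  *-nonneg {y = y} (inj₂ refl) _ = inj₂ (sym (zeroˡ y))

  0<t*x⇒0<x : ∀ {t x} → 0# ≤ x → 0# < t * x → 0# < x
  0<t*x⇒0<x (inj₁ 0<x) _ = 0<x
  0<t*x⇒0<x {t} (inj₂ refl) 0<t*0 = ⊥-elim (<-irrefl (sym (zeroʳ t)) 0<t*0)

  0<x⇒-x<0 : ∀ {x} → 0# < x → - x < 0#
  0<x⇒-x<0 {x} 0<x = subst₂ _<_ (+-identityˡ (- x)) (-‿inverseʳ x) (+-mono-< (- x) 0<x)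

  x<0⇒0<-x : ∀ {x} → x < 0# → 0# < - x
  x<0⇒0<-x {x} x<0 = subst₂ _<_ (-‿inverseʳ x) (+-identityˡ (- x)) (+-mono-< (- x) x<0)

  -x*-y≡x*y : ∀ x y → - x * - y ≡ x * y
  -x*-y≡x*y x y = begin
    - x * - y     ≡⟨ sym (-‿distribˡ-* x (- y)) ⟩
    - (x * - y)   ≡⟨ cong -_ (sym (-‿distribʳ-* x y)) ⟩
    - - (x * y)   ≡⟨ -‿involutive (x * y) ⟩
    x * y         ∎
    where open ≡-Reasoning

  0<1 : 0# < 1#
  0<1 with compare 0# 1#
  ... | tri< 0<1 _ _ = 0<1
  ... | tri≈ _ 0≡1 _ = ⊥-elim (0≢1 0≡1)
  ... | tri> _ _ 1<0 = ⊥-elim (<-asym 1<0 0<1*1)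
    where
    0<1*1 : 0# < 1#
    0<1*1 = subst (0# <_) (trans (-x*-y≡x*y 1# 1#) (*-identityˡ 1#))
                  (*-pos (x<0⇒0<-x 1<0) (x<0⇒0<-x 1<0))

  x≤y⇒0≤y-x : ∀ {x y} → x ≤ y → 0# ≤ y - x
  x≤y⇒0≤y-x {x} {y} x≤y = subst (_≤ y - x) (-‿inverseʳ x) (+-mono-≤ (- x) x≤y)

  0<c⇒x-c<x : ∀ {x c} → 0# < c → x - c < x
  0<c⇒x-c<x {x} 0<c = subst (x - _ <_) (+-identityʳ x) (+-monoʳ-< x (0<x⇒-x<0 0<c))

  inverse-positive : ∀ {s t} → 0# < s → s * t ≡ 1# → 0# < t
  inverse-positive {s} {t} 0<s st≡1 with compare 0# t
  ... | tri< 0<t _ _ = 0<t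
  ... | tri≈ _ refl _ = ⊥-elim (0≢1 (trans (sym (zeroʳ s)) st≡1))
  ... | tri> _ _ t<0 = ⊥-elim (<-asym 0<1 (subst (_< 0#) st≡1 st<0))
    where
    st<0 : s * t < 0#
    st<0 = subst (_< 0#) (-‿involutive (s * t))
             (0<x⇒-x<0 (subst (0# <_) (sym (-‿distribʳ-* s t)) (*-pos 0<s (x<0⇒0<-x t<0))))

  x+[y-x]≡y : ∀ x y → x + (y - x) ≡ y
  x+[y-x]≡y x y = begin
    x + (y - x)   ≡⟨ +-comm x (y - x) ⟩
    y - x + x     ≡⟨ +-assoc y (- x) x ⟩
    y + (- x + x) ≡⟨ cong (y +_) (-‿inverseˡ x) ⟩
    y + 0#        ≡⟨ +-identityʳ y ⟩
    y             ∎
    where open ≡-Reasoning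

  x-0≡x : ∀ x → x - 0# ≡ x
  x-0≡x x = trans (sym (+-identityˡ (x - 0#))) (x+[y-x]≡y 0# x)

module Summation (ℝ : Reals) where
  open Reals ℝ
  open OrderedFieldProperties ℝ

  ∑-cong : ∀ {k} {f g : Fin k → Carrier} → f ≗ g → ∑ ℝ f ≡ ∑ ℝ g
  ∑-cong {zero} f≗g = refl
  ∑-cong {suc k} f≗g = cong₂ _+_ (f≗g fzero) (∑-cong (λ x → f≗g (fsuc x)))

  ∑-+ : ∀ {k} (f g : Fin k → Carrier) → ∑ ℝ (λ x → f x + g x) ≡ ∑ ℝ f + ∑ ℝ g
  ∑-+ {zero} f g = sym (+-identityˡ 0#)
  ∑-+ {suc k} f g = trans (cong (f fzero + g fzero +_) (∑-+ (λ x → f (fsuc x)) (λ x → g (fsuc x))))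
                          (interchange _ _ _ _)

  *-distribˡ-∑ : ∀ {k} a (f : Fin k → Carrier) → a * ∑ ℝ f ≡ ∑ ℝ (λ x → a * f x)
  *-distribˡ-∑ {zero} a f = zeroʳ a
  *-distribˡ-∑ {suc k} a f = trans (distribˡ a _ _) (cong (a * f fzero +_) (*-distribˡ-∑ a (λ x → f (fsuc x))))

  *-distribʳ-∑ : ∀ {k} a (f : Fin k → Carrier) → ∑ ℝ f * a ≡ ∑ ℝ (λ x → f x * a)
  *-distribʳ-∑ a f = trans (*-comm _ a) (trans (*-distribˡ-∑ a f) (∑-cong (λ x → *-comm a (f x))))

  ∑-0 : ∀ {k} → ∑ ℝ {k} (λ _ → 0#) ≡ 0#
  ∑-0 {zero} = refl
  ∑-0 {suc k} = trans (+-identityˡ _) (∑-0 {k})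

  ∑-nonneg : ∀ {k} {f : Fin k → Carrier} → (∀ x → 0# ≤ f x) → 0# ≤ ∑ ℝ f
  ∑-nonneg {zero} _ = ≤-refl
  ∑-nonneg {suc k} 0≤f = +-nonneg (0≤f fzero) (∑-nonneg (λ x → 0≤f (fsuc x)))

  ∑-nonneg-≡0 : ∀ {k} {f : Fin k → Carrier} → (∀ x → 0# ≤ f x) → ∑ ℝ f ≡ 0# → ∀ x → f x ≡ 0#
  ∑-nonneg-≡0 {suc k} 0≤f ∑≡0 x with +-nonneg-≡0 (0≤f fzero) (∑-nonneg (λ x → 0≤f (fsuc x))) ∑≡0
  ∑-nonneg-≡0 {suc k} 0≤f ∑≡0 fzero | f0≡0 , _ = f0≡0
  ∑-nonneg-≡0 {suc k} 0≤f ∑≡0 (fsuc x) | _ , rest≡0 = ∑-nonneg-≡0 (λ x → 0≤f (fsuc x)) rest≡0 x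

  ∑-single : ∀ {k} (c : Fin k) {f : Fin k → Carrier} → (∀ x → x ≢ c → f x ≡ 0#) → ∑ ℝ f ≡ f c
  ∑-single {suc k} fzero {f} vanish =
    trans (cong (f fzero +_) (trans (∑-cong {g = λ _ → 0#} (λ x → vanish (fsuc x) λ ())) (∑-0 {k})))
          (+-identityʳ _)
  ∑-single {suc k} (fsuc c) vanish =
    trans (cong₂ _+_ (vanish fzero λ ()) (∑-single c (λ x x≢c → vanish (fsuc x) (x≢c ∘ suc-injective))))
          (+-identityˡ _)

  module _ {n : ℕ} where

    ∑ᴹ-cong : ∀ r {f g : MultiIndex ℝ n r → Carrier} → f ≗ g → ∑ᴹ ℝ r f ≡ ∑ᴹ ℝ r g
    ∑ᴹ-cong zero f≗g = f≗g _
    ∑ᴹ-cong (suc r) f≗g = ∑-cong (λ x → ∑ᴹ-cong r (λ t → f≗g (x ◂ t)))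

    ∑ᴹ-+ : ∀ r (f g : MultiIndex ℝ n r → Carrier) → ∑ᴹ ℝ r (λ j → f j + g j) ≡ ∑ᴹ ℝ r f + ∑ᴹ ℝ r g
    ∑ᴹ-+ zero f g = refl
    ∑ᴹ-+ (suc r) f g = trans (∑-cong (λ x → ∑ᴹ-+ r (λ t → f (x ◂ t)) (λ t → g (x ◂ t)))) (∑-+ {n} _ _)

    *-distribˡ-∑ᴹ : ∀ r a (f : MultiIndex ℝ n r → Carrier) → a * ∑ᴹ ℝ r f ≡ ∑ᴹ ℝ r (λ j → a * f j)
    *-distribˡ-∑ᴹ zero a f = refl
    *-distribˡ-∑ᴹ (suc r) a f =
      trans (*-distribˡ-∑ {n} a _) (∑-cong (λ x → *-distribˡ-∑ᴹ r a (λ t → f (x ◂ t))))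

    ∑ᴹ-0 : ∀ r → ∑ᴹ ℝ r (λ (_ : MultiIndex ℝ n r) → 0#) ≡ 0#
    ∑ᴹ-0 zero = refl
    ∑ᴹ-0 (suc r) = trans (∑-cong {n} (λ _ → ∑ᴹ-0 r)) (∑-0 {n})

    ∑ᴹ-nonneg : ∀ r {f : MultiIndex ℝ n r → Carrier} → (∀ j → 0# ≤ f j) → 0# ≤ ∑ᴹ ℝ r f
    ∑ᴹ-nonneg zero 0≤f = 0≤f _
    ∑ᴹ-nonneg (suc r) 0≤f = ∑-nonneg (λ x → ∑ᴹ-nonneg r (λ t → 0≤f (x ◂ t)))

    ∑ᴹ-[f-c*g] : ∀ r c (f g : MultiIndex ℝ n r → Carrier) →
      ∑ᴹ ℝ r (λ j → f j - c * g j) ≡ ∑ᴹ ℝ r f - c * ∑ᴹ ℝ r g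
    ∑ᴹ-[f-c*g] r c f g = begin
      ∑ᴹ ℝ r (λ j → f j - c * g j)       ≡⟨ ∑ᴹ-+ r f _ ⟩
      ∑ᴹ ℝ r f + ∑ᴹ ℝ r (λ j → - (c * g j)) ≡⟨ cong (∑ᴹ ℝ r f +_) (∑ᴹ-cong r (λ j → -‿distribˡ-* c (g j))) ⟩
      ∑ᴹ ℝ r f + ∑ᴹ ℝ r (λ j → - c * g j) ≡⟨ cong (∑ᴹ ℝ r f +_) (sym (*-distribˡ-∑ᴹ r (- c) g)) ⟩
      ∑ᴹ ℝ r f + - c * ∑ᴹ ℝ r g          ≡⟨ cong (∑ᴹ ℝ r f +_) (sym (-‿distribˡ-* c _)) ⟩
      ∑ᴹ ℝ r f - c * ∑ᴹ ℝ r g            ∎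
      where open ≡-Reasoning

    ∑ᴹ-nonneg-≡0 : ∀ r {f : MultiIndex ℝ n r → Carrier} → Extensional f →
      (∀ j → 0# ≤ f j) → ∑ᴹ ℝ r f ≡ 0# → ∀ j → f j ≡ 0#
    ∑ᴹ-nonneg-≡0 zero ext _ ∑≡0 j = trans (ext (λ ())) ∑≡0
    ∑ᴹ-nonneg-≡0 (suc r) ext 0≤f ∑≡0 j =
      trans (ext (head◂tail j))
        (∑ᴹ-nonneg-≡0 r (◂-extensional (head j) ext) (λ t → 0≤f (head j ◂ t))
          (∑-nonneg-≡0 (λ x → ∑ᴹ-nonneg r (λ t → 0≤f (x ◂ t))) ∑≡0 (head j)) (tail j))

    ∑ᴹ-∏ : ∀ r (h : Fin r → Fin n → Carrier) →
      ∑ᴹ ℝ r (λ j → ∏ ℝ (λ a → h a (j a))) ≡ ∏ ℝ (λ a → ∑ ℝ (h a))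
    ∑ᴹ-∏ zero h = refl
    ∑ᴹ-∏ (suc r) h = begin
      ∑ ℝ (λ x → ∑ᴹ ℝ r (λ t → h fzero x * ∏ ℝ (λ a → h (fsuc a) (t a))))
        ≡⟨ ∑-cong (λ x → sym (*-distribˡ-∑ᴹ r (h fzero x) _)) ⟩
      ∑ ℝ (λ x → h fzero x * ∑ᴹ ℝ r (λ t → ∏ ℝ (λ a → h (fsuc a) (t a))))
        ≡⟨ ∑-cong (λ x → cong (h fzero x *_) (∑ᴹ-∏ r (λ a → h (fsuc a)))) ⟩
      ∑ ℝ (λ x → h fzero x * ∏ ℝ (λ a → ∑ ℝ (h (fsuc a))))
        ≡⟨ sym (*-distribʳ-∑ _ (h fzero)) ⟩
      ∑ ℝ (h fzero) * ∏ ℝ (λ a → ∑ ℝ (h (fsuc a)))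
        ∎
      where open ≡-Reasoning

module Minima (ℝ : Reals) where
  open Reals ℝ
  open OrderedFieldProperties ℝ

  argminᶠ : ∀ {k} (f : Fin (suc k) → Carrier) → ∃ λ x₀ → ∀ x → f x₀ ≤ f x
  argminᶠ f = argmin f fzero (allFin _) , λ x → All.lookup (f[argmin]≤f[xs] fzero (allFin _)) (∈-allFin x)
    where open import Data.List.Extrema ≤-totalOrder using (argmin; f[argmin]≤f[xs])

  argminᴹ : ∀ {m} r (f : MultiIndex ℝ (suc m) r → Carrier) → Extensional f → ∃ λ j₀ → ∀ j → f j₀ ≤ f j
  argminᴹ zero f ext = (λ ()) , λ j → inj₂ (ext (λ ()))
  argminᴹ {m} (suc r) f ext = x₀ ◂ proj₁ (inner x₀) , λ j →
    ≤-trans (proj₂ outer (head j)) (≤-trans (proj₂ (inner (head j)) (tail j)) (inj₂ (sym (ext (head◂tail j)))))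
    where
    inner : ∀ x → ∃ λ t₀ → ∀ t → f (x ◂ t₀) ≤ f (x ◂ t)
    inner x = argminᴹ r (λ t → f (x ◂ t)) (◂-extensional x ext)
    outer : ∃ λ x₀ → ∀ x → f (x₀ ◂ proj₁ (inner x₀)) ≤ f (x ◂ proj₁ (inner x))
    outer = argminᶠ (λ x → f (x ◂ proj₁ (inner x)))
    x₀ : Fin (suc m)
    x₀ = proj₁ outer

module Counting where

  ∑ℕ : ∀ {k} → (Fin k → ℕ) → ℕ
  ∑ℕ {zero} f = 0
  ∑ℕ {suc k} f = f fzero ℕ.+ ∑ℕ (λ x → f (fsuc x))

  ∑ℕᴹ : ∀ {n} r → ((Fin r → Fin n) → ℕ) → ℕ
  ∑ℕᴹ zero f = f (λ ())
  ∑ℕᴹ (suc r) f = ∑ℕ (λ x → ∑ℕᴹ r (λ t → f (x ◂ t)))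

  ∑ℕ-cong : ∀ {k} {f g : Fin k → ℕ} → f ≗ g → ∑ℕ f ≡ ∑ℕ g
  ∑ℕ-cong {zero} _ = refl
  ∑ℕ-cong {suc k} f≗g = cong₂ ℕ._+_ (f≗g fzero) (∑ℕ-cong (λ x → f≗g (fsuc x)))

  ∑ℕᴹ-cong : ∀ {n} r {f g : (Fin r → Fin n) → ℕ} → f ≗ g → ∑ℕᴹ r f ≡ ∑ℕᴹ r g
  ∑ℕᴹ-cong zero f≗g = f≗g _
  ∑ℕᴹ-cong {n} (suc r) f≗g = ∑ℕ-cong {n} (λ x → ∑ℕᴹ-cong r (λ t → f≗g (x ◂ t)))

  ∑ℕ-mono : ∀ {k} {f g : Fin k → ℕ} → (∀ x → f x ℕ.≤ g x) → ∑ℕ f ℕ.≤ ∑ℕ g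
  ∑ℕ-mono {zero} _ = z≤n
  ∑ℕ-mono {suc k} f≤g = ℕₚ.+-mono-≤ (f≤g fzero) (∑ℕ-mono (λ x → f≤g (fsuc x)))

  ∑ℕ-mono-< : ∀ {k} {f g : Fin k → ℕ} → (∀ x → f x ℕ.≤ g x) → ∀ x₀ → f x₀ ℕ.< g x₀ → ∑ℕ f ℕ.< ∑ℕ g
  ∑ℕ-mono-< f≤g fzero f<g = ℕₚ.+-mono-<-≤ f<g (∑ℕ-mono (λ x → f≤g (fsuc x)))
  ∑ℕ-mono-< f≤g (fsuc x₀) f<g = ℕₚ.+-mono-≤-< (f≤g fzero) (∑ℕ-mono-< (λ x → f≤g (fsuc x)) x₀ f<g)

  ∑ℕᴹ-mono : ∀ {n} r {f g : (Fin r → Fin n) → ℕ} → (∀ j → f j ℕ.≤ g j) → ∑ℕᴹ r f ℕ.≤ ∑ℕᴹ r g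
  ∑ℕᴹ-mono zero f≤g = f≤g _
  ∑ℕᴹ-mono (suc r) f≤g = ∑ℕ-mono (λ x → ∑ℕᴹ-mono r (λ t → f≤g (x ◂ t)))

  ∑ℕᴹ-mono-< : ∀ {n} r {f g : (Fin r → Fin n) → ℕ} → Extensional f → Extensional g →
    (∀ j → f j ℕ.≤ g j) → ∀ j₀ → f j₀ ℕ.< g j₀ → ∑ℕᴹ r f ℕ.< ∑ℕᴹ r g
  ∑ℕᴹ-mono-< zero extf extg _ j₀ f<g = subst₂ ℕ._<_ (extf (λ ())) (extg (λ ())) f<g
  ∑ℕᴹ-mono-< (suc r) extf extg f≤g j₀ f<g =
    ∑ℕ-mono-< (λ x → ∑ℕᴹ-mono r (λ t → f≤g (x ◂ t))) (head j₀)
      (∑ℕᴹ-mono-< r (◂-extensional (head j₀) extf) (◂-extensional (head j₀) extg)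
        (λ t → f≤g (head j₀ ◂ t)) (tail j₀)
        (subst₂ ℕ._<_ (extf (head◂tail j₀)) (extg (head◂tail j₀)) f<g))

module KroneckerPowers (ℝ : Reals) where
  open Reals ℝ
  open OrderedFieldProperties ℝ
  open Summation ℝ

  module _ {n : ℕ} where

    δ-≡ : ∀ {a b : Fin n} → a ≡ b → δ ℝ a b ≡ 1#
    δ-≡ {a} {b} a≡b with a ≟ᶠ b
    ... | yes _ = refl
    ... | no a≢b = ⊥-elim (a≢b a≡b)

    δ-≢ : ∀ {a b : Fin n} → a ≢ b → δ ℝ a b ≡ 0#
    δ-≢ {a} {b} a≢b with a ≟ᶠ b
    ... | yes a≡b = ⊥-elim (a≢b a≡b)
    ... | no _ = refl

    ∑-δˡ : ∀ (b : Fin n) → ∑ ℝ (λ x → δ ℝ x b) ≡ 1#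
    ∑-δˡ b = trans (∑-single b {λ x → δ ℝ x b} (λ _ → δ-≢)) (δ-≡ {a = b} refl)

    ∑-δ-perm : ∀ (w : Permutation′ n) b → ∑ ℝ (λ x → δ ℝ b (w ⟨$⟩ʳ x)) ≡ 1#
    ∑-δ-perm w b =
      trans (∑-single (w ⟨$⟩ˡ b) {λ x → δ ℝ b (w ⟨$⟩ʳ x)} off-support) (δ-≡ {a = b} (sym (inverseʳ w)))
      where
      off-support : ∀ x → x ≢ w ⟨$⟩ˡ b → δ ℝ b (w ⟨$⟩ʳ x) ≡ 0#
      off-support x x≢w⁻¹b = δ-≢ (λ b≡wx → x≢w⁻¹b (trans (sym (inverseˡ w)) (cong (w ⟨$⟩ˡ_) (sym b≡wx))))

  ∏-1 : ∀ {k} {f : Fin k → Carrier} → (∀ a → f a ≡ 1#) → ∏ ℝ f ≡ 1#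
  ∏-1 {zero} _ = refl
  ∏-1 {suc k} f≡1 = trans (cong₂ _*_ (f≡1 fzero) (∏-1 (λ a → f≡1 (fsuc a)))) (*-identityˡ 1#)

  ∏-0 : ∀ {k} {f : Fin k → Carrier} a → f a ≡ 0# → ∏ ℝ f ≡ 0#
  ∏-0 {f = f} fzero fa≡0 = trans (cong (_* ∏ ℝ (λ a → f (fsuc a))) fa≡0) (zeroˡ _)
  ∏-0 (fsuc a) fa≡0 = trans (cong (_ *_) (∏-0 a fa≡0)) (zeroʳ _)

  ∏-cong : ∀ {k} {f g : Fin k → Carrier} → f ≗ g → ∏ ℝ f ≡ ∏ ℝ g
  ∏-cong {zero} _ = refl
  ∏-cong {suc k} f≗g = cong₂ _*_ (f≗g fzero) (∏-cong (λ a → f≗g (fsuc a)))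

  module _ {n r : ℕ} where

    _⟨$⟩ᴹ_ : Permutation′ n → MultiIndex ℝ n r → MultiIndex ℝ n r
    (w ⟨$⟩ᴹ j) a = w ⟨$⟩ʳ j a

    kronPerm-≗ : ∀ w {i j : MultiIndex ℝ n r} → i ≗ w ⟨$⟩ᴹ j → kronPerm ℝ r w i j ≡ 1#
    kronPerm-≗ w i≗wj = ∏-1 (λ a → δ-≡ (i≗wj a))

    kronPerm-≭ : ∀ w {i j : MultiIndex ℝ n r} → ¬ (i ≗ w ⟨$⟩ᴹ j) → kronPerm ℝ r w i j ≡ 0#
    kronPerm-≭ w {i} {j} i≭wj with ¬∀⟶∃¬ r _ (λ a → i a ≟ᶠ (w ⟨$⟩ᴹ j) a) i≭wj
    ... | a , iₐ≢wjₐ = ∏-0 a (δ-≢ iₐ≢wjₐ)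

    kronPerm-diagonal : ∀ w (j : MultiIndex ℝ n r) → kronPerm ℝ r w (w ⟨$⟩ᴹ j) j ≡ 1#
    kronPerm-diagonal w j = kronPerm-≗ w (λ _ → refl)

    kronPerm-nonneg : ∀ w (i j : MultiIndex ℝ n r) → 0# ≤ kronPerm ℝ r w i j
    kronPerm-nonneg w i j with i ≟ᴹ (w ⟨$⟩ᴹ j)
    ... | yes i≗wj = subst (0# ≤_) (sym (kronPerm-≗ w i≗wj)) (inj₁ 0<1)
    ... | no i≭wj = inj₂ (sym (kronPerm-≭ w i≭wj))

    kronPerm-extensional : ∀ w {i i′ j j′ : MultiIndex ℝ n r} → i ≗ i′ → j ≗ j′ →
      kronPerm ℝ r w i j ≡ kronPerm ℝ r w i′ j′
    kronPerm-extensional w i≗i′ j≗j′ = ∏-cong (λ a → cong₂ (δ ℝ) (i≗i′ a) (cong (w ⟨$⟩ʳ_) (j≗j′ a)))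

    kronPerm-rowSum : ∀ w (i : MultiIndex ℝ n r) → ∑ᴹ ℝ r (kronPerm ℝ r w i) ≡ 1#
    kronPerm-rowSum w i = trans (∑ᴹ-∏ r (λ a x → δ ℝ (i a) (w ⟨$⟩ʳ x))) (∏-1 (λ a → ∑-δ-perm w (i a)))

    kronPerm-colSum : ∀ w (j : MultiIndex ℝ n r) → ∑ᴹ ℝ r (λ i → kronPerm ℝ r w i j) ≡ 1#
    kronPerm-colSum w j = trans (∑ᴹ-∏ r (λ a x → δ ℝ x (w ⟨$⟩ʳ j a))) (∏-1 (λ a → ∑-δˡ (w ⟨$⟩ʳ j a)))

module BirkhoffDecomposition (ℝ : Reals) where
  open Reals ℝ
  open OrderedFieldProperties ℝ
  open Summation ℝ
  open KroneckerPowers ℝ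
  open Minima ℝ
  open Counting

  Coefficients : ℕ → Set
  Coefficients n = List (Carrier × Permutation′ n)

  Extensionalᴹ : ∀ {n r} → Matrix ℝ n r → Set
  Extensionalᴹ M = ∀ {i i′ j j′} → i ≗ i′ → j ≗ j′ → M i j ≡ M i′ j′

  -- With s = 1# these are definitionally DoublyStochastic and InConvexHull.
  ScaledDoublyStochastic : ∀ {n} r → Carrier → Matrix ℝ n r → Set
  ScaledDoublyStochastic r s M =
    (∀ i j → 0# ≤ M i j) × (∀ i → ∑ᴹ ℝ r (λ j → M i j) ≡ s) × (∀ j → ∑ᴹ ℝ r (λ i → M i j) ≡ s)

  InScaledConvexHull : ∀ {n} r → Carrier → Matrix ℝ n r → Set
  InScaledConvexHull {n} r s M = ∃ λ (cs : Coefficients n) →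
    All (λ p → 0# ≤ proj₁ p) cs × coeffSum ℝ cs ≡ s × _≈ᴹ_ ℝ M (combination ℝ r cs)

  module _ {n r : ℕ} where

    combination-extensional : ∀ (cs : Coefficients n) → Extensionalᴹ (combination ℝ r cs)
    combination-extensional [] _ _ = refl
    combination-extensional ((c , w) ∷ cs) i≗i′ j≗j′ =
      cong₂ _+_ (cong (c *_) (kronPerm-extensional w i≗i′ j≗j′)) (combination-extensional cs i≗i′ j≗j′)

    inSpan⇒extensional : ∀ {M : Matrix ℝ n r} → InSpan ℝ r M → Extensionalᴹ M
    inSpan⇒extensional {M} (cs , M≈cs) {i} {i′} {j} {j′} i≗i′ j≗j′ =
      trans (M≈cs i j) (trans (combination-extensional cs i≗i′ j≗j′) (sym (M≈cs i′ j′)))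

    combination-lineSum : ∀ (cs : Coefficients n) (ι κ : MultiIndex ℝ n r → MultiIndex ℝ n r) →
      (∀ w → ∑ᴹ ℝ r (λ k → kronPerm ℝ r w (ι k) (κ k)) ≡ 1#) →
      ∑ᴹ ℝ r (λ k → combination ℝ r cs (ι k) (κ k)) ≡ coeffSum ℝ cs
    combination-lineSum [] ι κ _ = ∑ᴹ-0 r
    combination-lineSum ((c , w) ∷ cs) ι κ kronPerm-line = begin
      ∑ᴹ ℝ r (λ k → c * kronPerm ℝ r w (ι k) (κ k) + combination ℝ r cs (ι k) (κ k))
        ≡⟨ ∑ᴹ-+ r _ _ ⟩
      ∑ᴹ ℝ r (λ k → c * kronPerm ℝ r w (ι k) (κ k)) + ∑ᴹ ℝ r (λ k → combination ℝ r cs (ι k) (κ k))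
        ≡⟨ cong₂ _+_ (sym (*-distribˡ-∑ᴹ r c _)) (combination-lineSum cs ι κ kronPerm-line) ⟩
      c * ∑ᴹ ℝ r (λ k → kronPerm ℝ r w (ι k) (κ k)) + coeffSum ℝ cs
        ≡⟨ cong (λ x → c * x + coeffSum ℝ cs) (kronPerm-line w) ⟩
      c * 1# + coeffSum ℝ cs
        ≡⟨ cong (_+ coeffSum ℝ cs) (*-identityʳ c) ⟩
      c + coeffSum ℝ cs
        ∎
      where open ≡-Reasoning

    combination-nonneg : ∀ {cs : Coefficients n} → All (λ p → 0# ≤ proj₁ p) cs →
      ∀ i j → 0# ≤ combination ℝ r cs i j
    combination-nonneg [] i j = ≤-refl
    combination-nonneg {(c , w) ∷ _} (0≤c ∷ 0≤cs) i j =
      +-nonneg (*-nonneg 0≤c (kronPerm-nonneg w i j)) (combination-nonneg 0≤cs i j)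

    scaledConvexHull⇒scaledDoublyStochastic : ∀ {s} {M : Matrix ℝ n r} →
      InScaledConvexHull r s M → ScaledDoublyStochastic r s M
    scaledConvexHull⇒scaledDoublyStochastic (cs , 0≤cs , ∑cs≡s , M≈cs) =
      (λ i j → subst (0# ≤_) (sym (M≈cs i j)) (combination-nonneg 0≤cs i j)) ,
      (λ i → trans (∑ᴹ-cong r (M≈cs i))
                   (trans (combination-lineSum cs (λ _ → i) id (λ w → kronPerm-rowSum w i)) ∑cs≡s)) ,
      (λ j → trans (∑ᴹ-cong r (λ i → M≈cs i j))
                   (trans (combination-lineSum cs id (λ _ → j) (λ w → kronPerm-colSum w j)) ∑cs≡s))

    zeroLineSums⇒zero : ∀ {M : Matrix ℝ n r} → Extensionalᴹ M → ScaledDoublyStochastic r 0# M →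
      ∀ i j → M i j ≡ 0#
    zeroLineSums⇒zero ext (0≤M , rows , _) i =
      ∑ᴹ-nonneg-≡0 r (ext (λ _ → refl)) (0≤M i) (rows i)

    convexHull⇒inΩ : ∀ {M : Matrix ℝ n r} → InConvexHull ℝ r M → InΩ ℝ r M
    convexHull⇒inΩ hull@(cs , _ , _ , M≈cs) = scaledConvexHull⇒scaledDoublyStochastic hull , (cs , M≈cs)

    combination-posKronDiagonal : ∀ {cs : Coefficients n} → All (λ p → 0# ≤ proj₁ p) cs →
      0# < coeffSum ℝ cs → HasPosKronDiagonal ℝ r (combination ℝ r cs)
    combination-posKronDiagonal [] 0<0 = ⊥-elim (<-irrefl refl 0<0)
    combination-posKronDiagonal {(c , w) ∷ cs} (inj₁ 0<c ∷ 0≤cs) _ = w , λ j →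
      +-pos-nonneg (subst (0# <_) (sym (trans (cong (c *_) (kronPerm-diagonal w j)) (*-identityʳ c))) 0<c)
                   (combination-nonneg 0≤cs _ j)
    combination-posKronDiagonal {(_ , w) ∷ cs} (inj₂ refl ∷ 0≤cs) 0<∑cs
      with combination-posKronDiagonal 0≤cs (subst (0# <_) (+-identityˡ _) 0<∑cs)
    ... | w′ , 0<diagonal = w′ , λ j →
      subst (0# <_) (sym (trans (cong (_+ combination ℝ r cs (w′ ⟨$⟩ᴹ j) j) (zeroˡ _)) (+-identityˡ _)))
            (0<diagonal j)

    scaledConvexHull⇒posKronDiagonal : ∀ {s} {M : Matrix ℝ n r} → 0# < s →
      InScaledConvexHull r s M → HasPosKronDiagonal ℝ r M
    scaledConvexHull⇒posKronDiagonal 0<s (cs , 0≤cs , refl , M≈cs)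
      with combination-posKronDiagonal 0≤cs 0<s
    ... | w , 0<diagonal = w , λ j → subst (0# <_) (sym (M≈cs _ j)) (0<diagonal j)

    scaleCoefficients : Carrier → Coefficients n → Coefficients n
    scaleCoefficients t [] = []
    scaleCoefficients t ((c , w) ∷ cs) = (t * c , w) ∷ scaleCoefficients t cs

    combination-scale : ∀ t (cs : Coefficients n) i j →
      combination ℝ r (scaleCoefficients t cs) i j ≡ t * combination ℝ r cs i j
    combination-scale t [] i j = sym (zeroʳ t)
    combination-scale t ((c , w) ∷ cs) i j =
      trans (cong₂ _+_ (*-assoc t c _) (combination-scale t cs i j)) (sym (distribˡ t _ _))

    scaledDoublyStochastic-inΩ : ∀ {s t} {M : Matrix ℝ n r} → 0# < s → s * t ≡ 1# →
      ScaledDoublyStochastic r s M → InSpan ℝ r M → InΩ ℝ r (λ i j → t * M i j)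
    scaledDoublyStochastic-inΩ {s} {t} 0<s st≡1 (0≤M , rows , cols) (cs , M≈cs) =
      ((λ i j → *-nonneg (inj₁ (inverse-positive 0<s st≡1)) (0≤M i j)) ,
       (λ i → trans (sym (*-distribˡ-∑ᴹ r t _)) (t*s≡1 (rows i))) ,
       (λ j → trans (sym (*-distribˡ-∑ᴹ r t _)) (t*s≡1 (cols j)))) ,
      (scaleCoefficients t cs , λ i j → trans (cong (t *_) (M≈cs i j)) (sym (combination-scale t cs i j)))
      where
      t*s≡1 : ∀ {x} → x ≡ s → t * x ≡ 1#
      t*s≡1 refl = trans (*-comm t s) st≡1

    subtractKronPerm : Matrix ℝ n r → Carrier → Permutation′ n → Matrix ℝ n r
    subtractKronPerm M c w i j = M i j - c * kronPerm ℝ r w i j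

    subtractKronPerm-inSpan : ∀ {M} c w → InSpan ℝ r M → InSpan ℝ r (subtractKronPerm M c w)
    subtractKronPerm-inSpan c w (cs , M≈cs) = (- c , w) ∷ cs , λ i j →
      trans (cong₂ _+_ (M≈cs i j) (-‿distribˡ-* c _)) (+-comm _ _)

    subtractKronPerm-≗ : ∀ M c w {i j} → i ≗ w ⟨$⟩ᴹ j → subtractKronPerm M c w i j ≡ M i j - c
    subtractKronPerm-≗ M c w {i} {j} i≗wj =
      cong (λ x → M i j - x) (trans (cong (c *_) (kronPerm-≗ w i≗wj)) (*-identityʳ c))

    subtractKronPerm-≭ : ∀ M c w {i j} → ¬ (i ≗ w ⟨$⟩ᴹ j) → subtractKronPerm M c w i j ≡ M i j
    subtractKronPerm-≭ M c w {i} {j} i≭wj = begin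
      M i j - c * kronPerm ℝ r w i j ≡⟨ cong (λ p → M i j - c * p) (kronPerm-≭ w i≭wj) ⟩
      M i j - c * 0#                 ≡⟨ cong (λ x → M i j - x) (zeroʳ c) ⟩
      M i j - 0#                     ≡⟨ x-0≡x (M i j) ⟩
      M i j ∎
      where open ≡-Reasoning

    subtractKronPerm-scaledDoublyStochastic : ∀ {M s c} w → Extensionalᴹ M → (∀ j → c ≤ M (w ⟨$⟩ᴹ j) j) →
      ScaledDoublyStochastic r s M → ScaledDoublyStochastic r (s - c) (subtractKronPerm M c w)
    subtractKronPerm-scaledDoublyStochastic {M} {s} {c} w ext c≤diagonal (0≤M , rows , cols) =
      nonneg ,
      (λ i → trans (∑ᴹ-[f-c*g] r c (M i) (kronPerm ℝ r w i)) (lineSum (rows i) (kronPerm-rowSum w i))) ,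
      (λ j → trans (∑ᴹ-[f-c*g] r c (λ i → M i j) (λ i → kronPerm ℝ r w i j))
                   (lineSum (cols j) (kronPerm-colSum w j)))
      where
      nonneg : ∀ i j → 0# ≤ subtractKronPerm M c w i j
      nonneg i j with i ≟ᴹ (w ⟨$⟩ᴹ j)
      ... | yes i≗wj = subst (0# ≤_) (sym (subtractKronPerm-≗ M c w i≗wj))
                         (x≤y⇒0≤y-x (≤-trans (c≤diagonal j) (inj₂ (ext (λ a → sym (i≗wj a)) (λ _ → refl)))))
      ... | no i≭wj = subst (0# ≤_) (sym (subtractKronPerm-≭ M c w i≭wj)) (0≤M i j)
      lineSum : ∀ {x y} → x ≡ s → y ≡ 1# → x - c * y ≡ s - c
      lineSum refl refl = cong (λ x → s - x) (*-identityʳ c)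

    subtractKronPerm-pos⇒pos : ∀ {M c} w → 0# < c → ∀ i j → 0# < subtractKronPerm M c w i j → 0# < M i j
    subtractKronPerm-pos⇒pos {M} {c} w 0<c i j 0<M′ with i ≟ᴹ (w ⟨$⟩ᴹ j)
    ... | yes i≗wj = <-trans (subst (0# <_) (subtractKronPerm-≗ M c w i≗wj) 0<M′) (0<c⇒x-c<x 0<c)
    ... | no i≭wj = subst (0# <_) (subtractKronPerm-≭ M c w i≭wj) 0<M′

    subtractKronPerm-diagonal : ∀ M w j →
      subtractKronPerm M (M (w ⟨$⟩ᴹ j) j) w (w ⟨$⟩ᴹ j) j ≡ 0#
    subtractKronPerm-diagonal M w j = trans (subtractKronPerm-≗ M _ w (λ _ → refl)) (-‿inverseʳ _)

    scaledConvexHull-addKronPerm : ∀ {M s c} w → 0# ≤ c →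
      InScaledConvexHull r (s - c) (subtractKronPerm M c w) → InScaledConvexHull r s M
    scaledConvexHull-addKronPerm {M} {s} {c} w 0≤c (cs , 0≤cs , ∑cs≡s-c , M′≈cs) =
      (c , w) ∷ cs , 0≤c ∷ 0≤cs , trans (cong (c +_) ∑cs≡s-c) (x+[y-x]≡y c s) ,
      λ i j → trans (sym (x+[y-x]≡y (c * kronPerm ℝ r w i j) (M i j)))
                    (cong (c * kronPerm ℝ r w i j +_) (M′≈cs i j))

  positive : Carrier → ℕ
  positive x with 0# <? x
  ... | yes _ = 1
  ... | no _ = 0

  positive-mono : ∀ {x y} → (0# < y → 0# < x) → positive y ℕ.≤ positive x
  positive-mono {x} {y} pos⇒pos with 0# <? y | 0# <? x
  ... | yes _ | yes _ = s≤s z≤n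
  ... | yes 0<y | no 0≮x = ⊥-elim (0≮x (pos⇒pos 0<y))
  ... | no _ | _ = z≤n

  positive-< : ∀ {x y} → 0# < x → ¬ 0# < y → positive y ℕ.< positive x
  positive-< {x} {y} 0<x 0≮y with 0# <? y | 0# <? x
  ... | yes 0<y | _ = ⊥-elim (0≮y 0<y)
  ... | no _ | yes _ = s≤s z≤n
  ... | no _ | no 0≮x = ⊥-elim (0≮x 0<x)

  module _ {n r : ℕ} where

    positiveEntries : Matrix ℝ n r → ℕ
    positiveEntries M = ∑ℕᴹ r (λ i → ∑ℕᴹ r (λ j → positive (M i j)))

    positiveEntries-< : ∀ {M M′ : Matrix ℝ n r} → Extensionalᴹ M → Extensionalᴹ M′ →
      (∀ i j → 0# < M′ i j → 0# < M i j) → ∀ i₀ j₀ → 0# < M i₀ j₀ → ¬ 0# < M′ i₀ j₀ →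
      positiveEntries M′ ℕ.< positiveEntries M
    positiveEntries-< ext ext′ pos⇒pos i₀ j₀ 0<M 0≮M′ =
      ∑ℕᴹ-mono-< r (λ i≗i′ → ∑ℕᴹ-cong r (λ j → cong positive (ext′ i≗i′ (λ _ → refl))))
                   (λ i≗i′ → ∑ℕᴹ-cong r (λ j → cong positive (ext i≗i′ (λ _ → refl))))
        (λ i → ∑ℕᴹ-mono r (λ j → positive-mono (pos⇒pos i j))) i₀
        (∑ℕᴹ-mono-< r (λ j≗j′ → cong positive (ext′ (λ _ → refl) j≗j′))
                      (λ j≗j′ → cong positive (ext (λ _ → refl) j≗j′))
          (λ j → positive-mono (pos⇒pos i₀ j)) j₀ (positive-< 0<M 0≮M′))

  PosKronDiagonalProperty : ℕ → ℕ → Set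
  PosKronDiagonalProperty n r = ∀ (M : Matrix ℝ n r) → InΩ ℝ r M → HasPosKronDiagonal ℝ r M

  module _ {m r : ℕ} where

    lineSum-nonneg : ∀ {s} {M : Matrix ℝ (suc m) r} → ScaledDoublyStochastic r s M → 0# ≤ s
    lineSum-nonneg (0≤M , rows , _) = subst (0# ≤_) (rows (λ _ → fzero)) (∑ᴹ-nonneg r (0≤M _))

    posKronDiagonal-scaled : PosKronDiagonalProperty (suc m) r → ∀ {s} {M : Matrix ℝ (suc m) r} → 0# < s →
      ScaledDoublyStochastic r s M → InSpan ℝ r M → HasPosKronDiagonal ℝ r M
    posKronDiagonal-scaled hyp {s} 0<s ds span with inverse s (λ s≡0 → <-irrefl (sym s≡0) 0<s)
    ... | t , st≡1 with hyp _ (scaledDoublyStochastic-inΩ 0<s st≡1 ds span)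
    ... | w , 0<tM = w , λ j → 0<t*x⇒0<x (proj₁ ds _ j) (0<tM j)

    peelKronPerm : PosKronDiagonalProperty (suc m) r → ∀ {s} {M : Matrix ℝ (suc m) r} → 0# < s →
      InSpan ℝ r M → ScaledDoublyStochastic r s M →
      ∃₂ λ c w → 0# < c × InSpan ℝ r (subtractKronPerm M c w) ×
        ScaledDoublyStochastic r (s - c) (subtractKronPerm M c w) ×
        positiveEntries (subtractKronPerm M c w) ℕ.< positiveEntries M
    peelKronPerm hyp {s} {M} 0<s span ds with posKronDiagonal-scaled hyp 0<s ds span
    ... | w , 0<diagonal
      with argminᴹ r (λ j → M (w ⟨$⟩ᴹ j) j)
             (λ j≗j′ → inSpan⇒extensional span (λ a → cong (w ⟨$⟩ʳ_) (j≗j′ a)) j≗j′)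
    ... | j₀ , minimal =
      c , w , 0<c , span′ , subtractKronPerm-scaledDoublyStochastic w (inSpan⇒extensional span) minimal ds ,
      positiveEntries-< (inSpan⇒extensional span) (inSpan⇒extensional span′)
        (subtractKronPerm-pos⇒pos w 0<c) _ j₀ 0<c
        (λ 0<M′ → <-irrefl (sym (subtractKronPerm-diagonal M w j₀)) 0<M′)
      where
      c : Carrier
      c = M (w ⟨$⟩ᴹ j₀) j₀
      0<c : 0# < c
      0<c = 0<diagonal j₀
      span′ : InSpan ℝ r (subtractKronPerm M c w)
      span′ = subtractKronPerm-inSpan c w span

    decompose : PosKronDiagonalProperty (suc m) r → ∀ fuel {s} {M : Matrix ℝ (suc m) r} →
      positiveEntries M ℕ.< fuel → InSpan ℝ r M → ScaledDoublyStochastic r s M →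
      InScaledConvexHull r s M
    decompose hyp (suc fuel) {s} {M} (s≤s <fuel) span ds with compare 0# s
    ... | tri> _ _ s<0 = ⊥-elim (<-irrefl refl (≤-<-trans (lineSum-nonneg ds) s<0))
    ... | tri≈ _ refl _ = [] , [] , refl , zeroLineSums⇒zero (inSpan⇒extensional span) ds
    ... | tri< 0<s _ _ = case peelKronPerm hyp 0<s span ds of λ where
      (c , w , 0<c , span′ , ds′ , fewer) →
        scaledConvexHull-addKronPerm w (inj₁ 0<c) (decompose hyp fuel (ℕₚ.<-≤-trans fewer <fuel) span′ ds′)

    inΩ⇒convexHull : PosKronDiagonalProperty (suc m) r → ∀ {M : Matrix ℝ (suc m) r} →
      InΩ ℝ r M → InConvexHull ℝ r M
    inΩ⇒convexHull hyp {M} (ds , span) = decompose hyp (suc (positiveEntries M)) ℕₚ.≤-refl span ds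

open import Data.Nat using (_≤_)

proposition2 : (ℝ : Reals) (n r : ℕ) → 1 ≤ n → 1 ≤ r →
    ((∀ (M : Matrix ℝ n r) → (InΩ ℝ r M → InConvexHull ℝ r M) × (InConvexHull ℝ r M → InΩ ℝ r M))
    ⇔ (∀ (M : Matrix ℝ n r) → InΩ ℝ r M → HasPosKronDiagonal ℝ r M))
proposition2 ℝ (suc m) r (s≤s _) _ =
  mk⇔ (λ Ω≡hull M M∈Ω → scaledConvexHull⇒posKronDiagonal 0<1 (proj₁ (Ω≡hull M) M∈Ω))
      (λ hyp M → inΩ⇒convexHull hyp , convexHull⇒inΩ)
  where
  open OrderedFieldProperties ℝ using (0<1)
  open BirkhoffDecomposition ℝ
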